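{- Let $G$ be a subcubic graph that is not a cycle, and let $\mathcal{C}(G)$ be the multigraph obtained from $G$ by replacing every subdivided path by a single edge joining its ends. If $\mathcal{C}(G)$ has a separating matching, then $G$ has a matching cut.
   Context: A subcubic graph is a simple graph with maximum degree at most $3$. A path in $G$ is called subdivided if it has at least two edges, both of its ends have degree at least $3$ in $G$, and every internal vertex has degree $2$ in $G$. $\mathcal{C}(G)$ may have parallel edges. A matching in a multigraph is a set of pairwise vertex-disjoint non-loop edges; it is separating if its removal increases the number of connected components. A matching cut of $G$ is a matching that equals the set of all edges between $X$ and $V(G)\setminus X$ for some nonempty proper subset $X\subseteq V(G)$. -}

module Defs where

open import Data.Nat using (ℕ; _≤_; _<_; _∸_)
open import Data.Bool using (Bool; true; false; T)
open import Data.Fin as Fin using (Fin)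
open import Data.Fin.Subset as Sub using (Subset; ∣_∣)
open import Data.Vec using (tabulate)
open import Data.List using (List; []; _∷_; _++_; length)
open import Data.List.Membership.Propositional as LMem using ()
open import Data.List.Relation.Unary.All as All using (All)
open import Data.List.Relation.Unary.Linked using (Linked)
open import Data.List.Relation.Unary.Unique.Propositional using (Unique)
open import Data.Product using (Σ; ∃; ∃₂; _×_; _,_; proj₁; proj₂)
open import Data.Sum using (_⊎_; inj₁; inj₂)
open import Data.Unit using (⊤)
open import Data.Empty using (⊥)
open import Data.Irrelevant as Irr using (Irrelevant)
open import Data.Refinement using (Refinement; _,_; Refinement-syntax)
open import Relation.Nullary using (¬_)
open import Relation.Binary.PropositionalEquality using (_≡_; _≢_; subst)
open import Data.Nat.Properties using (<-irrefl)

record Graph (n : ℕ) : Set where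
  field
    adj   : Fin n → Fin n → Bool
    sym   : ∀ u v → adj u v ≡ adj v u
    irrefl : ∀ u → adj u u ≡ false

module _ {n : ℕ} (G : Graph n) where
  open Graph G

  Adj : Fin n → Fin n → Set
  Adj u v = T (adj u v)

  deg : Fin n → ℕ
  deg u = ∣ tabulate (adj u) ∣

  Subcubic : Set
  Subcubic = ∀ u → deg u ≤ 3

  data GReach : Fin n → Fin n → Set where
    here : ∀ {u} → GReach u u
    step : ∀ {u v w} → GReach u v → Adj v w → GReach u w

  Connected : Set
  Connected = ∀ u v → GReach u v

  IsCycle : Set
  IsCycle = (0 < n) × Connected × (∀ v → deg v ≡ 2)

  IsPath : List (Fin n) → Set
  IsPath l = Linked Adj l × Unique l

  numEdges : List (Fin n) → ℕ
  numEdges l = length l ∸ 1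

  pathList : Fin n → List (Fin n) → Fin n → List (Fin n)
  pathList a xs b = a ∷ (xs ++ b ∷ [])

  SubdividedPath : Fin n → List (Fin n) → Fin n → Set
  SubdividedPath a xs b =
    IsPath (pathList a xs b) × (2 ≤ numEdges (pathList a xs b)) ×
    (3 ≤ deg a) × (3 ≤ deg b) × All (λ v → deg v ≡ 2) xs

  Internal : Fin n → Set
  Internal v = ∃₂ λ a xs → ∃ λ b → SubdividedPath a xs b × v LMem.∈ xs

  Consecutive : List (Fin n) → Fin n → Fin n → Set
  Consecutive l u v = ∃₂ λ ys zs → l ≡ ys ++ (u ∷ v ∷ zs)

  OnSubdivided : Fin n → Fin n → Set
  OnSubdivided u v = ∃₂ λ a xs → ∃ λ b → SubdividedPath a xs b ×
    (Consecutive (pathList a xs b) u v ⊎ Consecutive (pathList a xs b) v u)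

  end-not-internal₁ : ∀ {a xs b} → SubdividedPath a xs b → ¬ Internal a
  end-not-internal₁ (_ , _ , d , _ , _) (_ , _ , _ , (_ , _ , _ , _ , all2) , a∈) =
    <-irrefl refl′ (subst (3 ≤_) (All.lookup all2 a∈) d)
    where
      open import Relation.Binary.PropositionalEquality using () renaming (refl to refl′)

  end-not-internal₂ : ∀ {a xs b} → SubdividedPath a xs b → ¬ Internal b
  end-not-internal₂ (_ , _ , _ , d , _) (_ , _ , _ , (_ , _ , _ , _ , all2) , b∈) =
    <-irrefl refl′ (subst (3 ≤_) (All.lookup all2 b∈) d)
    where
      open import Relation.Binary.PropositionalEquality using () renaming (refl to refl′)

  CutEdge : Subset n → Fin n → Fin n → Set
  CutEdge X u v = Adj u v × ((u Sub.∈ X × v Sub.∉ X) ⊎ (u Sub.∉ X × v Sub.∈ X))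

  IsMatchingG : (Fin n → Fin n → Set) → Set
  IsMatchingG F = ∀ u v w → F u v → F u w → v ≡ w

  HasMatchingCut : Set
  HasMatchingCut = Σ (Subset n) λ X →
    (∃ λ x → x Sub.∈ X) × (∃ λ y → y Sub.∉ X) × IsMatchingG (CutEdge X)

-- Multigraphs (parallel edges and loops allowed): vertex type, edge type,
-- and the two ends of every edge.

record Multigraph : Set₁ where
  field
    V    : Set
    E    : Set
    end₁ : E → V
    end₂ : E → V

module _ (H : Multigraph) where
  open Multigraph H

  Joins : E → V → V → Set
  Joins e v w = (end₁ e ≡ v × end₂ e ≡ w) ⊎ (end₂ e ≡ v × end₁ e ≡ w)

  data Reach (allowed : E → Set) : V → V → Set where
    here : ∀ {u} → Reach allowed u u
    step : ∀ {u v w} (e : E) → Reach allowed u v → allowed e → Joins e v w →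
           Reach allowed u w

  -- the spanning subgraph with edge set `allowed` has exactly k components:
  -- there are k representatives in pairwise distinct components, covering V
  NumComponents : (E → Set) → ℕ → Set
  NumComponents allowed k = Σ (Fin k → V) λ r →
    (∀ i j → Reach allowed (r i) (r j) → i ≡ j) ×
    (∀ v → ∃ λ i → Reach allowed (r i) v)

  IsMatching : (E → Set) → Set
  IsMatching M =
    (∀ e → M e → end₁ e ≢ end₂ e) ×
    (∀ e f → M e → M f → e ≢ f →
       (end₁ e ≢ end₁ f) × (end₁ e ≢ end₂ f) × (end₂ e ≢ end₁ f) × (end₂ e ≢ end₂ f))

  IsSeparating : (E → Set) → Set
  IsSeparating M = ∃₂ λ k k′ →
    NumComponents (λ _ → ⊤) k × NumComponents (λ e → ¬ M e) k′ × k < k′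

  HasSeparatingMatching : Set₁
  HasSeparatingMatching = Σ (E → Set) λ M → IsMatching M × IsSeparating M

-- C(G): delete the internal vertices of subdivided paths; keep the edges
-- of G not on any subdivided path; add one edge per subdivided path
-- (each path counted once, oriented so that its first end is smaller).

module _ {n : ℕ} (G : Graph n) where
  open Graph G

  CVertex : Set
  CVertex = [ v ∈ Fin n ∣ ¬ Internal G v ]

  -- (the last two conjuncts are implied by the third; they are included
  --  only to make the ends of the edge vertices of C(G))
  CDirectEdge : Set
  CDirectEdge = [ uv ∈ Fin n × Fin n ∣
    Adj G (proj₁ uv) (proj₂ uv) × proj₁ uv Fin.< proj₂ uv ×
    ¬ OnSubdivided G (proj₁ uv) (proj₂ uv) ×
    ¬ Internal G (proj₁ uv) × ¬ Internal G (proj₂ uv) ]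

  CPathEdge : Set
  CPathEdge = [ p ∈ Fin n × List (Fin n) × Fin n ∣
    SubdividedPath G (proj₁ p) (proj₁ (proj₂ p)) (proj₂ (proj₂ p)) ×
    proj₁ p Fin.< proj₂ (proj₂ p) ]

  CEdge : Set
  CEdge = CDirectEdge ⊎ CPathEdge

  Cend₁ : CEdge → CVertex
  Cend₁ (inj₁ ((u , v) , pf)) =
    u , Irr.map (λ q → proj₁ (proj₂ (proj₂ (proj₂ q)))) pf
  Cend₁ (inj₂ ((a , xs , b) , pf)) =
    a , Irr.map (λ q → end-not-internal₁ G (proj₁ q)) pf

  Cend₂ : CEdge → CVertex
  Cend₂ (inj₁ ((u , v) , pf)) =
    v , Irr.map (λ q → proj₂ (proj₂ (proj₂ (proj₂ q)))) pf
  Cend₂ (inj₂ ((a , xs , b) , pf)) =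
    b , Irr.map (λ q → end-not-internal₂ G (proj₁ q)) pf

  𝒞 : Multigraph
  𝒞 = record { V = CVertex ; E = CEdge ; end₁ = Cend₁ ; end₂ = Cend₂ }

{-# OPTIONS --safe #-}
module Submission where

-- Removing the separating matching M from C(G) leaves at least two components; colour a vertex
-- of C(G) true iff it lies in the component of a fixed vertex.  Both colours occur, and every
-- bichromatic edge of C(G) lies in M.  Give an internal vertex of a subdivided path with ends a
-- and b the colour (colour a ∧ colour b); this is well defined because walking through degree-2
-- vertices from an internal vertex reaches the same two ends whichever path it is taken on.
-- A bichromatic edge of G at a vertex u of C(G) lies on a bichromatic edge of C(G) at u, and
-- distinct ones on distinct ones; as those are in M, u has at most one.  An internal vertex has
-- the colour of one of the two ends, so at most one of its edges is bichromatic.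

open import Defs
open import Data.Nat using (ℕ; zero; suc; _≤_; _∸_; z≤n; s≤s)
import Data.Nat.Properties as ℕP
open import Data.Bool using (Bool; true; false; T; T?; _∧_)
open import Data.Bool.Properties using (T-≡; ∧-sel; ∧-idem; ∧-comm)
open import Data.Fin using (Fin; zero; suc; toℕ; fromℕ<)
import Data.Fin.Properties as FinP
open import Data.Fin.Subset as Sub using (Subset; ∣_∣)
import Data.Fin.Subset.Properties as SubP
open import Data.Vec using (tabulate)
import Data.Vec.Properties as VecP
open import Data.List using (List; []; _∷_; _++_; length; reverse; reverseAcc)
import Data.List.Properties as LP
open import Data.List.Membership.Propositional using (_∈_)
open import Data.List.Membership.Propositional.Properties using (∈-++⁺ʳ; ∈-++⁻)
open import Data.List.Relation.Unary.Any using (here; there)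
import Data.List.Relation.Unary.Any.Properties as AnyP
open import Data.List.Relation.Unary.All as All using (All; []; _∷_)
open import Data.List.Relation.Unary.AllPairs using ([]; _∷_)
open import Data.List.Relation.Unary.Linked as Linked using (Linked; []; [-]; _∷_)
open import Data.List.Relation.Unary.Unique.Propositional using (Unique)
open import Data.List.Relation.Binary.Permutation.Propositional using (↭⇒↭ₛ; ↭-sym)
open import Data.List.Relation.Binary.Permutation.Propositional.Properties using (↭-reverse)
import Data.List.Relation.Binary.Permutation.Setoid.Properties as ↭ₛ
open import Data.Product as Product using (∃; ∃₂; _×_; _,_; proj₁; proj₂)
open import Data.Sum as Sum using (_⊎_; inj₁; inj₂)
open import Data.Empty using (⊥; ⊥-elim)
import Data.Empty.Irrelevant as Irrelevant
open import Data.Irrelevant using ([_])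
open import Data.Refinement using (_,_; value)
open import Function using (_∘_; flip; case_of_)
open import Function.Bundles using (Equivalence)
open import Relation.Nullary using (¬_; Dec; yes; no)
open import Relation.Nullary.Decidable using (_×-dec_)
open import Relation.Unary using (Decidable)
open import Relation.Binary.PropositionalEquality
open import Relation.Binary.PropositionalEquality.Properties using (setoid)
open import Relation.Binary.Definitions using (tri<; tri≈; tri>)

private variable
  A : Set
  R : A → A → Set
  a a′ b b′ u v v′ : A
  xs ys zs : List A

Linked-++⁻ʳ : ∀ (xs : List A) → Linked R (xs ++ ys) → Linked R ys
Linked-++⁻ʳ []       linked = linked
Linked-++⁻ʳ (_ ∷ xs) linked = Linked-++⁻ʳ xs (Linked.tail linked)

Unique-++⁻ʳ : ∀ (xs : List A) → Unique (xs ++ ys) → Unique ys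
Unique-++⁻ʳ []       unique       = unique
Unique-++⁻ʳ (_ ∷ xs) (_ ∷ unique) = Unique-++⁻ʳ xs unique

Linked-reverseAcc⁺ : ∀ (x : A) xs acc → Linked R (x ∷ xs) → Linked (flip R) (x ∷ acc) →
                     Linked (flip R) (reverseAcc (x ∷ acc) xs)
Linked-reverseAcc⁺ x []       acc _          reversed = reversed
Linked-reverseAcc⁺ x (y ∷ ys) acc (r ∷ rest) reversed = Linked-reverseAcc⁺ y ys (x ∷ acc) rest (r ∷ reversed)

Linked-reverse⁺ : Linked R xs → Linked (flip R) (reverse xs)
Linked-reverse⁺ {xs = []}     _      = []
Linked-reverse⁺ {xs = x ∷ xs} linked = Linked-reverseAcc⁺ x xs [] linked [-]

Unique-reverse⁺ : Unique xs → Unique (reverse xs)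
Unique-reverse⁺ {xs = xs} = ↭ₛ.Unique-resp-↭ (setoid _) (↭⇒↭ₛ (↭-sym (↭-reverse xs)))

All-reverse⁺ : ∀ {P : A → Set} → All P xs → All P (reverse xs)
All-reverse⁺ all = All.tabulate (All.lookup all ∘ AnyP.reverse⁻)

reverse-∷-++-∷ : ∀ (a : A) xs b → reverse (a ∷ xs ++ b ∷ []) ≡ b ∷ reverse xs ++ a ∷ []
reverse-∷-++-∷ a xs b = begin
  reverse (a ∷ xs ++ b ∷ [])       ≡⟨ LP.unfold-reverse a (xs ++ b ∷ []) ⟩
  reverse (xs ++ b ∷ []) ++ a ∷ [] ≡⟨ cong (_++ a ∷ []) (LP.reverse-++ xs (b ∷ [])) ⟩
  b ∷ reverse xs ++ a ∷ []         ∎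
  where open ≡-Reasoning

∈-∷-++-∷⁻ : ∀ (xs : List A) → u ∈ a ∷ xs ++ b ∷ [] → u ∈ xs ⊎ u ≡ a ⊎ u ≡ b
∈-∷-++-∷⁻ xs (here refl) = inj₂ (inj₁ refl)
∈-∷-++-∷⁻ xs (there u∈) with ∈-++⁻ xs u∈
... | inj₁ u∈xs        = inj₁ u∈xs
... | inj₂ (here refl) = inj₂ (inj₂ refl)

headOr : List A → A → A
headOr []      b = b
headOr (x ∷ _) _ = x

headOr∈ : ∀ (xs : List A) b → headOr xs b ∈ xs ++ b ∷ []
headOr∈ []      b = here refl
headOr∈ (_ ∷ _) b = here refl

headOr-++-∷ : ∀ (xs : List A) → xs ++ b ∷ [] ≡ v ∷ ys → headOr xs b ≡ v
headOr-++-∷ []      eq = LP.∷-injectiveˡ eq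
headOr-++-∷ (_ ∷ _) eq = LP.∷-injectiveˡ eq

Linked-headOr : ∀ (x : A) xs b → Linked R (x ∷ xs ++ b ∷ []) → R x (headOr xs b)
Linked-headOr x []      b (r ∷ _) = r
Linked-headOr x (_ ∷ _) b (r ∷ _) = r

∈-∃-between : ∀ (a : A) xs b → v ∈ xs →
  ∃ λ ls → ∃₂ λ q s → ∃ λ rs → a ∷ xs ++ b ∷ [] ≡ ls ++ q ∷ v ∷ s ∷ rs
∈-∃-between a (_ ∷ [])     b (here refl) = [] , a , b , [] , refl
∈-∃-between a (_ ∷ y ∷ ys) b (here refl) = [] , a , y , ys ++ b ∷ [] , refl
∈-∃-between a (x ∷ xs)     b (there v∈xs) with ∈-∃-between x xs b v∈xs
... | ls , q , s , rs , eq = a ∷ ls , q , s , rs , cong (a ∷_) eq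

++-∷-≡-++-∷-∷⇒∈ : ∀ (xs ls : List A) → xs ++ b ∷ [] ≡ ls ++ u ∷ v ∷ zs → u ∈ xs
++-∷-≡-++-∷-∷⇒∈ []       []       ()
++-∷-≡-++-∷-∷⇒∈ []       (_ ∷ ls) eq with LP.++-conicalʳ ls _ (sym (LP.∷-injectiveʳ eq))
... | ()
++-∷-≡-++-∷-∷⇒∈ (_ ∷ xs) []       eq = here (sym (LP.∷-injectiveˡ eq))
++-∷-≡-++-∷-∷⇒∈ (_ ∷ xs) (_ ∷ ls) eq = there (++-∷-≡-++-∷-∷⇒∈ xs ls (LP.∷-injectiveʳ eq))

consecutive-interior : ∀ (x : A) xs ls → a ∷ (x ∷ xs) ++ b ∷ [] ≡ ls ++ u ∷ v ∷ zs →
  u ∈ x ∷ xs ⊎ v ∈ x ∷ xs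
consecutive-interior x xs []       eq = inj₂ (here (sym (LP.∷-injectiveˡ (LP.∷-injectiveʳ eq))))
consecutive-interior x xs (_ ∷ ls) eq = inj₁ (++-∷-≡-++-∷-∷⇒∈ (x ∷ xs) ls (LP.∷-injectiveʳ eq))

any-of-length? : ∀ {n} m {P : List (Fin n) → Set} → Decidable P → Dec (∃ λ l → length l ≡ m × P l)
any-of-length? zero P? with P? []
... | yes p = yes ([] , refl , p)
... | no ¬p = no λ { ([] , _ , p) → ¬p p ; (_ ∷ _ , () , _) }
any-of-length? (suc m) P? with FinP.any? (λ x → any-of-length? m (P? ∘ (x ∷_)))
... | yes (x , l , refl , p) = yes (x ∷ l , refl , p)
... | no ¬p = no λ { ([] , () , _) ; (x ∷ l , refl , p) → ¬p (x , l , refl , p) }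

any-bounded? : ∀ {n} N {P : List (Fin n) → Set} → Decidable P → (∀ {l} → P l → length l ≤ N) →
               Dec (∃ P)
any-bounded? N P? bounded with FinP.any? (λ (m : Fin (suc N)) → any-of-length? (toℕ m) P?)
... | yes (_ , l , _ , p) = yes (l , p)
... | no ¬p = no λ (l , p) → ¬p (fromℕ< (s≤s (bounded p)) , l , sym (FinP.toℕ-fromℕ< _) , p)

Unique⇒length≤∣p∣ : ∀ {n} (p : Subset n) {xs : List (Fin n)} →
  Unique xs → All (Sub._∈ p) xs → length xs ≤ ∣ p ∣
Unique⇒length≤∣p∣ p []               []            = z≤n
Unique⇒length≤∣p∣ p {x ∷ _} (x∉xs ∷ unique) (x∈p ∷ xs⊆p) = ℕP.≤-trans
  (s≤s (Unique⇒length≤∣p∣ (p Sub.- x) unique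
    (All.zipWith (λ (y∈p , x≢y) → SubP.x∈p∧x≢y⇒x∈p-y y∈p (x≢y ∘ sym)) (xs⊆p , x∉xs))))
  (SubP.x∈p⇒∣p-x∣<∣p∣ x∈p)

Unique⇒length≤n : ∀ {n} {xs : List (Fin n)} → Unique xs → length xs ≤ n
Unique⇒length≤n {n} unique = ℕP.≤-trans
  (Unique⇒length≤∣p∣ Sub.⊤ unique (All.tabulate λ _ → SubP.∈⊤)) (ℕP.≤-reflexive (SubP.∣⊤∣≡n n))

∈-tabulate⁺ : ∀ {n} {f : Fin n → Bool} {x} → f x ≡ true → x Sub.∈ tabulate f
∈-tabulate⁺ {f = f} {x} fx≡true =
  VecP.lookup⇒[]= x (tabulate f) (trans (VecP.lookup∘tabulate f x) fx≡true)

∈-tabulate⁻ : ∀ {n} {f : Fin n → Bool} {x} → x Sub.∈ tabulate f → f x ≡ true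
∈-tabulate⁻ {f = f} {x} x∈ = trans (sym (VecP.lookup∘tabulate f x)) (VecP.[]=⇒lookup x∈)

module _ {n : ℕ} (G : Graph n) where
  open Graph G using (adj)

  Adj-sym : ∀ {u v} → Adj G u v → Adj G v u
  Adj-sym {u} {v} = subst T (Graph.sym G u v)

  Adj-irrefl : ∀ {u v} → Adj G u v → u ≢ v
  Adj-irrefl {u} uu refl = subst T (Graph.irrefl G u) uu

  deg≡2⇒neighbour∈ : ∀ {v q s u} → deg G v ≡ 2 → Adj G v q → Adj G v s → q ≢ s → Adj G v u →
                     u ≡ q ⊎ u ≡ s
  deg≡2⇒neighbour∈ {v} {q} {s} {u} deg≡2 vq vs q≢s vu with u FinP.≟ q | u FinP.≟ s
  ... | yes u≡q | _       = inj₁ u≡q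
  ... | no _    | yes u≡s = inj₂ u≡s
  ... | no u≢q  | no u≢s  = ⊥-elim (ℕP.<-irrefl (sym deg≡2)
        (Unique⇒length≤∣p∣ (tabulate (adj v)) distinct (neighbour vq ∷ neighbour vs ∷ neighbour vu ∷ [])))
    where
    neighbour : ∀ {w} → Adj G v w → w Sub.∈ tabulate (adj v)
    neighbour = ∈-tabulate⁺ ∘ Equivalence.to T-≡
    distinct : Unique (q ∷ s ∷ u ∷ [])
    distinct = (q≢s ∷ (u≢q ∘ sym) ∷ []) ∷ ((u≢s ∘ sym) ∷ []) ∷ [] ∷ []

  data Thread : Fin n → Fin n → Fin n → Set where
    stop     : ∀ {p c} → 3 ≤ deg G c → Thread p c c
    continue : ∀ {p c d e} → deg G c ≡ 2 → Adj G c d → d ≢ p → Thread c d e → Thread p c e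

  Thread-functional : ∀ {p c e e′} → Adj G p c → Thread p c e → Thread p c e′ → e ≡ e′
  Thread-functional _ (stop _) (stop _) = refl
  Thread-functional _ (stop c≥3) (continue c≡2 _ _ _) = ⊥-elim (ℕP.<-irrefl (sym c≡2) c≥3)
  Thread-functional _ (continue c≡2 _ _ _) (stop c≥3) = ⊥-elim (ℕP.<-irrefl (sym c≡2) c≥3)
  Thread-functional pc (continue c≡2 cd d≢p thread) (continue _ cd′ d′≢p thread′)
    with deg≡2⇒neighbour∈ c≡2 (Adj-sym pc) cd (d≢p ∘ sym) cd′
  ... | inj₁ d′≡p = ⊥-elim (d′≢p d′≡p)
  ... | inj₂ refl = Thread-functional cd thread thread′

  Thread-along : ∀ p ys b → IsPath G (p ∷ ys ++ b ∷ []) → All (λ v → deg G v ≡ 2) ys →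
                 3 ≤ deg G b → Thread p (headOr ys b) b
  Thread-along p []       b _                              []            b≥3 = stop b≥3
  Thread-along p (y ∷ ys) b (_ ∷ linked , p∉rest ∷ unique) (y≡2 ∷ ys≡2) b≥3 =
    continue y≡2 (Linked-headOr y ys b linked)
      (λ next≡p → All.lookup p∉rest (there (headOr∈ ys b)) (sym next≡p))
      (Thread-along y ys b (linked , unique) ys≡2 b≥3)

  Thread-from : ∀ p ys b → IsPath G (p ∷ ys ++ b ∷ []) → All (λ v → deg G v ≡ 2) ys →
                3 ≤ deg G b → v ∈ ys → ∃ λ s → Adj G v s × Thread v s b
  Thread-from p (y ∷ ys) b (_ ∷ linked , _ ∷ unique) (_ ∷ ys≡2) b≥3 (here refl) =
    headOr ys b , Linked-headOr y ys b linked , Thread-along y ys b (linked , unique) ys≡2 b≥3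
  Thread-from p (y ∷ ys) b (_ ∷ linked , _ ∷ unique) (_ ∷ ys≡2) b≥3 (there v∈ys) =
    Thread-from y ys b (linked , unique) ys≡2 b≥3 v∈ys

  SubdividedPath-reverse : SubdividedPath G a xs b → SubdividedPath G b (reverse xs) a
  SubdividedPath-reverse {a = a} {xs = xs} {b = b} ((linked , unique) , long , a≥3 , b≥3 , xs≡2) =
    (subst (Linked (Adj G)) reversed (Linked.map Adj-sym (Linked-reverse⁺ linked)) ,
     subst Unique reversed (Unique-reverse⁺ unique)) ,
    subst (λ m → 2 ≤ m ∸ 1)
      (trans (sym (LP.length-reverse (pathList G a xs b))) (cong length reversed)) long ,
    b≥3 , a≥3 , All-reverse⁺ xs≡2
    where
    reversed : reverse (pathList G a xs b) ≡ pathList G b (reverse xs) a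
    reversed = reverse-∷-++-∷ a xs b

  SubdividedPath-ends-distinct : SubdividedPath G a xs b → a ≢ b
  SubdividedPath-ends-distinct {xs = xs} ((_ , a∉rest ∷ _) , _) =
    All.lookup a∉rest (∈-++⁺ʳ xs (here refl))

  SubdividedPath-length : SubdividedPath G a xs b → length xs ≤ n
  SubdividedPath-length {xs = xs} ((_ , unique) , _) =
    ℕP.≤-trans (LP.length-++-≤ˡ xs) (ℕP.≤-trans (ℕP.n≤1+n _) (Unique⇒length≤n unique))

  SubdividedPath? : ∀ a xs b → Dec (SubdividedPath G a xs b)
  SubdividedPath? a xs b =
    (Linked.linked? (λ x y → T? (adj x y)) _ ×-dec unique? _) ×-dec
    (2 ℕP.≤? numEdges G (pathList G a xs b)) ×-dec (3 ℕP.≤? deg G a) ×-dec (3 ℕP.≤? deg G b) ×-dec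
    All.all? (λ v → deg G v ℕP.≟ 2) xs
    where open import Data.List.Relation.Unary.Unique.DecPropositional (FinP._≟_ {n}) using (unique?)

  Internal? : ∀ v → Dec (Internal G v)
  Internal? v = FinP.any? λ a →
    any-bounded? n (λ xs → FinP.any? λ b → SubdividedPath? a xs b ×-dec (v ∈? xs))
      (λ (_ , path , _) → SubdividedPath-length path)
    where open import Data.List.Membership.DecPropositional (FinP._≟_ {n}) using (_∈?_)

  forward-thread : SubdividedPath G a xs b → v ∈ xs → ∃ λ s → Adj G v s × Thread v s b
  forward-thread {a = a} {xs = xs} {b = b} (path , _ , _ , b≥3 , xs≡2) = Thread-from a xs b path xs≡2 b≥3

  backward-thread : SubdividedPath G a xs b → v ∈ xs → ∃ λ s → Adj G v s × Thread v s a
  backward-thread path v∈xs = forward-thread (SubdividedPath-reverse path) (AnyP.reverse⁺ v∈xs)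

  internal-deg≡2 : SubdividedPath G a xs b → v ∈ xs → deg G v ≡ 2
  internal-deg≡2 (_ , _ , _ , _ , xs≡2) = All.lookup xs≡2

  internal-exits : SubdividedPath G a xs b → v ∈ xs → ∃₂ λ s q →
    Adj G v s × Thread v s b × Adj G v q × Thread v q a × (∀ {u} → Adj G v u → u ≡ s ⊎ u ≡ q)
  internal-exits path v∈xs with forward-thread path v∈xs | backward-thread path v∈xs
  ... | s , vs , to-b | q , vq , to-a = s , q , vs , to-b , vq , to-a ,
    deg≡2⇒neighbour∈ (internal-deg≡2 path v∈xs) vs vq
      (λ { refl → SubdividedPath-ends-distinct path (Thread-functional vs to-a to-b) })

  internal-determines-ends : SubdividedPath G a xs b → v ∈ xs → SubdividedPath G a′ ys b′ → v ∈ ys →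
                             (a ≡ a′ × b ≡ b′) ⊎ (a ≡ b′ × b ≡ a′)
  internal-determines-ends path v∈xs path′ v∈ys
    with internal-exits path v∈xs | forward-thread path′ v∈ys | backward-thread path′ v∈ys
  ... | s , q , vs , to-b , vq , to-a , exit | s′ , vs′ , to-b′ | q′ , vq′ , to-a′
    with exit vs′ | exit vq′
  ... | inj₁ refl | inj₁ refl = ⊥-elim (SubdividedPath-ends-distinct path′ (Thread-functional vs to-a′ to-b′))
  ... | inj₁ refl | inj₂ refl = inj₁ (Thread-functional vq to-a to-a′ , Thread-functional vs to-b to-b′)
  ... | inj₂ refl | inj₁ refl = inj₂ (Thread-functional vq to-a to-b′ , Thread-functional vs to-b to-a′)
  ... | inj₂ refl | inj₂ refl = ⊥-elim (SubdividedPath-ends-distinct path′ (Thread-functional vq to-a′ to-b′))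

  internal-path-neighbours : SubdividedPath G a xs b → v ∈ xs → ∃₂ λ ls q → ∃ λ rs →
    pathList G a xs b ≡ ls ++ q ∷ v ∷ rs × (∀ {u} → Adj G v u → u ∈ q ∷ v ∷ rs)
  internal-path-neighbours {a = a} {xs = xs} {b = b} {v = v} path@((linked , unique) , _) v∈xs
    with ∈-∃-between a xs b v∈xs
  ... | ls , q , s , rs , split
    with Linked-++⁻ʳ ls (subst (Linked (Adj G)) split linked) | Unique-++⁻ʳ ls (subst Unique split unique)
  ... | qv ∷ vs ∷ _ | (_ ∷ q≢s ∷ _) ∷ _ = ls , q , s ∷ rs , split , neighbour
    where
    neighbour : ∀ {u} → Adj G v u → u ∈ q ∷ v ∷ s ∷ rs
    neighbour vu with deg≡2⇒neighbour∈ (internal-deg≡2 path v∈xs) (Adj-sym qv) vs q≢s vu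
    ... | inj₁ refl = here refl
    ... | inj₂ refl = there (there (here refl))

  internal-neighbour : SubdividedPath G a xs b → v ∈ xs → Adj G v u → u ∈ xs ⊎ u ≡ a ⊎ u ≡ b
  internal-neighbour {xs = xs} path v∈xs vu with internal-path-neighbours path v∈xs
  ... | ls , _ , _ , split , neighbour =
    ∈-∷-++-∷⁻ xs (subst (_ ∈_) (sym split) (∈-++⁺ʳ ls (neighbour vu)))

  first-internal : SubdividedPath G a xs b → v ∈ xs → Adj G a v → v ≡ headOr xs b
  first-internal {a = a} {xs = xs} path v∈xs av with internal-path-neighbours path v∈xs
  ... | [] , _ , _ , split , _ = sym (headOr-++-∷ xs (LP.∷-injectiveʳ split))
  ... | _ ∷ ls , _ , _ , split , neighbour with path
  ...   | (_ , a∉rest ∷ _) , _ = ⊥-elim (All.lookup a∉rest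
          (subst (a ∈_) (sym (LP.∷-injectiveʳ split)) (∈-++⁺ʳ ls (neighbour (Adj-sym av)))) refl)

  last-internal : SubdividedPath G a xs b → v ∈ xs → Adj G b v → v ≡ headOr (reverse xs) a
  last-internal path v∈xs = first-internal (SubdividedPath-reverse path) (AnyP.reverse⁺ v∈xs)

  OnSubdivided⇒Internal : OnSubdivided G u v → Internal G u ⊎ Internal G v
  OnSubdivided⇒Internal (_ , [] , _ , (_ , s≤s () , _) , _)
  OnSubdivided⇒Internal (a , x ∷ xs , b , path , inj₁ (ls , _ , split)) =
    Sum.map internal internal (consecutive-interior x xs ls split)
    where
    internal : ∀ {w} → w ∈ x ∷ xs → Internal G w
    internal w∈ = a , x ∷ xs , b , path , w∈
  OnSubdivided⇒Internal (a , x ∷ xs , b , path , inj₂ (ls , _ , split)) =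
    Sum.swap (Sum.map internal internal (consecutive-interior x xs ls split))
    where
    internal : ∀ {w} → w ∈ x ∷ xs → Internal G w
    internal w∈ = a , x ∷ xs , b , path , w∈

  -- Carries u t e: e is the edge of C(G) containing the edge ut of G, and u is an end of e.
  data Carries (u t : Fin n) : CEdge G → Set where
    direct₁ : ∀ pf → Carries u t (inj₁ ((u , t) , pf))
    direct₂ : ∀ pf → Carries u t (inj₁ ((t , u) , pf))
    path₁   : ∀ {xs b} pf → SubdividedPath G u xs b → t ∈ xs → Carries u t (inj₂ ((u , xs , b) , pf))
    path₂   : ∀ {a xs} pf → SubdividedPath G a xs u → t ∈ xs → Carries u t (inj₂ ((a , xs , u) , pf))

  path-carrier : SubdividedPath G u xs b → v ∈ xs → ∃ (Carries u v)
  path-carrier {u = u} {xs = xs} {b = b} path v∈xs with FinP.<-cmp u b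
  ... | tri< u<b _ _ = inj₂ ((u , xs , b) , [ (path , u<b) ]) , path₁ _ path v∈xs
  ... | tri≈ _ u≡b _ = ⊥-elim (SubdividedPath-ends-distinct path u≡b)
  ... | tri> _ _ b<u = inj₂ ((b , reverse xs , u) , [ (reversed , b<u) ]) ,
                       path₂ _ reversed (AnyP.reverse⁺ v∈xs)
    where
    reversed : SubdividedPath G b (reverse xs) u
    reversed = SubdividedPath-reverse path

  direct-carrier : ¬ Internal G u → ¬ Internal G v → Adj G u v → ∃ (Carries u v)
  direct-carrier {u = u} {v = v} ¬iu ¬iv uv with FinP.<-cmp u v
  ... | tri< u<v _ _ = inj₁ ((u , v) , [ (uv , u<v , not-on , ¬iu , ¬iv) ]) , direct₁ _
    where
    not-on : ¬ OnSubdivided G u v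
    not-on = Sum.[ ¬iu , ¬iv ] ∘ OnSubdivided⇒Internal
  ... | tri≈ _ u≡v _ = ⊥-elim (Adj-irrefl uv u≡v)
  ... | tri> _ _ v<u = inj₁ ((v , u) , [ (Adj-sym uv , v<u , not-on , ¬iv , ¬iu) ]) , direct₂ _
    where
    not-on : ¬ OnSubdivided G v u
    not-on = Sum.[ ¬iv , ¬iu ] ∘ OnSubdivided⇒Internal

  carrier : ¬ Internal G u → Adj G u v → ∃ (Carries u v)
  carrier {v = v} ¬iu uv with Internal? v
  ... | no ¬iv = direct-carrier ¬iu ¬iv uv
  ... | yes (a , xs , b , path , v∈xs) with internal-neighbour path v∈xs (Adj-sym uv)
  ...   | inj₁ u∈xs        = ⊥-elim (¬iu (a , xs , b , path , u∈xs))
  ...   | inj₂ (inj₁ refl) = path-carrier path v∈xs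
  ...   | inj₂ (inj₂ refl) = path-carrier (SubdividedPath-reverse path) (AnyP.reverse⁺ v∈xs)

  Carries-functional : ∀ {e} → Adj G u v → Adj G u v′ → Carries u v e → Carries u v′ e → v ≡ v′
  Carries-functional _  _   (direct₁ _)           (direct₁ _)       = refl
  Carries-functional _  _   (direct₁ _)           (direct₂ _)       = refl
  Carries-functional _  _   (direct₂ _)           (direct₁ _)       = refl
  Carries-functional _  _   (direct₂ _)           (direct₂ _)       = refl
  Carries-functional uv uv′ (path₁ _ path v∈xs)   (path₁ _ _ v′∈xs) =
    trans (first-internal path v∈xs uv) (sym (first-internal path v′∈xs uv′))
  Carries-functional _  _   (path₁ _ path _)      (path₂ _ _ _)     =
    ⊥-elim (SubdividedPath-ends-distinct path refl)
  Carries-functional _  _   (path₂ _ path _)      (path₁ _ _ _)     =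
    ⊥-elim (SubdividedPath-ends-distinct path refl)
  Carries-functional uv uv′ (path₂ _ path v∈xs)   (path₂ _ _ v′∈xs) =
    trans (last-internal path v∈xs uv) (sym (last-internal path v′∈xs uv′))

module _ (H : Multigraph) where
  open Multigraph H

  Joins-sym : ∀ {e v w} → Joins H e v w → Joins H e w v
  Joins-sym = Sum.swap ∘ Sum.map Product.swap Product.swap

  Reach-trans : ∀ {allowed u v w} → Reach H allowed u v → Reach H allowed v w → Reach H allowed u w
  Reach-trans uv here                = uv
  Reach-trans uv (step e vw ok ends) = step e (Reach-trans uv vw) ok ends

  Reach-sym : ∀ {allowed u v} → Reach H allowed u v → Reach H allowed v u
  Reach-sym here                = here
  Reach-sym (step e uv ok ends) = Reach-trans (step e here ok (Joins-sym ends)) (Reach-sym uv)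

  Incident : E → V → Set
  Incident e x = end₁ e ≡ x ⊎ end₂ e ≡ x

  matching-incident : ∀ {M e e′ x} → IsMatching H M → M e → M e′ → Incident e x → Incident e′ x →
                      ¬ e ≢ e′
  matching-incident (_ , disjoint) Me Me′ ex e′x e≢e′ with disjoint _ _ Me Me′ e≢e′ | ex | e′x
  ... | d₁₁ , _ , _ , _ | inj₁ refl | inj₁ q = d₁₁ (sym q)
  ... | _ , d₁₂ , _ , _ | inj₁ refl | inj₂ q = d₁₂ (sym q)
  ... | _ , _ , d₂₁ , _ | inj₂ refl | inj₁ q = d₂₁ (sym q)
  ... | _ , _ , _ , d₂₂ | inj₂ refl | inj₂ q = d₂₂ (sym q)

  record CutWithin (M : E → Set) : Set where
    field
      side       : V → Bool
      uncut      : ∀ e → ¬ M e → side (end₁ e) ≡ side (end₂ e)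
      inner      : V
      outer      : V
      inner-side : side inner ≡ true
      outer-side : side outer ≡ false

  components⇒CutWithin : ∀ {M m} → NumComponents H (λ e → ¬ M e) (suc (suc m)) → CutWithin M
  components⇒CutWithin {M} (r , distinct , cover) = record
    { side       = isZero ∘ component
    ; uncut      = λ e ¬Me → cong isZero (component-step e ¬Me)
    ; inner      = r zero
    ; outer      = r (suc zero)
    ; inner-side = cong isZero (component-rep zero)
    ; outer-side = cong isZero (component-rep (suc zero))
    }
    where
    isZero : ∀ {k} → Fin k → Bool
    isZero zero    = true
    isZero (suc _) = false
    component : V → Fin _
    component x = proj₁ (cover x)
    component-rep : ∀ i → component (r i) ≡ i
    component-rep i = distinct _ i (proj₂ (cover (r i)))
    component-step : ∀ e → ¬ M e → component (end₁ e) ≡ component (end₂ e)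
    component-step e ¬Me = distinct _ _
      (Reach-trans (step e (proj₂ (cover (end₁ e))) ¬Me (inj₁ (refl , refl))) (Reach-sym (proj₂ (cover (end₂ e)))))

  separating⇒CutWithin : ∀ {M} → IsSeparating H M → CutWithin M
  separating⇒CutWithin (_     , zero        , _               , _          , ())
  separating⇒CutWithin (zero  , suc _       , (_ , _ , cover) , (r , _)    , _) with cover (r zero)
  ... | () , _
  separating⇒CutWithin (suc _ , suc zero    , _               , _          , s≤s ())
  separating⇒CutWithin (_     , suc (suc _) , _               , components , _) =
    components⇒CutWithin components

module _ {n : ℕ} {G : Graph n} {M : CEdge G → Set}
         (matching : IsMatching (𝒞 G) M) (cut : CutWithin (𝒞 G) M) where
  open CutWithin cut

  side′ : (v : Fin n) → .(¬ Internal G v) → Bool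
  side′ v ¬iv = side (v , [ ¬iv ])

  colour : Fin n → Bool
  colour v with Internal? G v
  ... | yes (a , _ , b , path , _) = side′ a (end-not-internal₁ G path) ∧ side′ b (end-not-internal₂ G path)
  ... | no ¬iv                     = side′ v ¬iv

  colour-external : (x : CVertex G) → colour (value x) ≡ side x
  colour-external (v , [ ¬iv ]) with Internal? G v
  ... | yes iv = Irrelevant.⊥-elim (¬iv iv)
  ... | no _   = refl

  colour-internal : (path : SubdividedPath G a xs b) → v ∈ xs →
    colour v ≡ side′ a (end-not-internal₁ G path) ∧ side′ b (end-not-internal₂ G path)
  colour-internal {a = a} {xs = xs} {b = b} {v = v} path v∈xs with Internal? G v
  ... | no ¬iv = ⊥-elim (¬iv (a , xs , b , path , v∈xs))
  ... | yes (_ , _ , _ , path′ , v∈xs′) with internal-determines-ends G path′ v∈xs′ path v∈xs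
  ...   | inj₁ (refl , refl) = refl
  ...   | inj₂ (refl , refl) = ∧-comm (side′ b _) (side′ a _)

  Carries⇒colour≡ : ∀ {u t e} → Carries G u t e → side (Cend₁ G e) ≡ side (Cend₂ G e) → colour u ≡ colour t
  Carries⇒colour≡ {e = e} (direct₁ _) same =
    trans (colour-external (Cend₁ G e)) (trans same (sym (colour-external (Cend₂ G e))))
  Carries⇒colour≡ {e = e} (direct₂ _) same =
    trans (colour-external (Cend₂ G e)) (trans (sym same) (sym (colour-external (Cend₁ G e))))
  Carries⇒colour≡ {e = e} (path₁ _ path t∈xs) same = begin
    colour (value (Cend₁ G e))          ≡⟨ colour-external (Cend₁ G e) ⟩
    side (Cend₁ G e)                    ≡⟨ ∧-idem _ ⟨
    side (Cend₁ G e) ∧ side (Cend₁ G e) ≡⟨ cong (side (Cend₁ G e) ∧_) same ⟩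
    side (Cend₁ G e) ∧ side (Cend₂ G e) ≡⟨ colour-internal path t∈xs ⟨
    colour _                            ∎
    where open ≡-Reasoning
  Carries⇒colour≡ {e = e} (path₂ _ path t∈xs) same = begin
    colour (value (Cend₂ G e))          ≡⟨ colour-external (Cend₂ G e) ⟩
    side (Cend₂ G e)                    ≡⟨ ∧-idem _ ⟨
    side (Cend₂ G e) ∧ side (Cend₂ G e) ≡⟨ cong (_∧ side (Cend₂ G e)) same ⟨
    side (Cend₁ G e) ∧ side (Cend₂ G e) ≡⟨ colour-internal path t∈xs ⟨
    colour _                            ∎
    where open ≡-Reasoning

  -- M need not be decidable, so a bichromatic edge is only shown to be doubly negated in M.
  bichromatic⇒¬¬M : ∀ {u t e} → Carries G u t e → colour u ≢ colour t → ¬ ¬ M e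
  bichromatic⇒¬¬M {e = e} carries bichromatic ¬Me = bichromatic (Carries⇒colour≡ carries (uncut e ¬Me))

  Carries⇒Incident : ∀ {u t e} .(¬iu : ¬ Internal G u) → Carries G u t e → Incident (𝒞 G) e (u , [ ¬iu ])
  Carries⇒Incident _ (direct₁ _)   = inj₁ refl
  Carries⇒Incident _ (direct₂ _)   = inj₂ refl
  Carries⇒Incident _ (path₁ _ _ _) = inj₁ refl
  Carries⇒Incident _ (path₂ _ _ _) = inj₂ refl

  cut-at-external : ∀ {u v w} → ¬ Internal G u → Adj G u v → Adj G u w →
                    colour u ≢ colour v → colour u ≢ colour w → v ≡ w
  cut-at-external {u} {v} {w} ¬iu uv uw uv-cut uw-cut with v FinP.≟ w
  ... | yes v≡w = v≡w
  ... | no v≢w with carrier G ¬iu uv | carrier G ¬iu uw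
  ...   | eᵥ , carriesᵥ | e_w , carries_w =
    ⊥-elim (bichromatic⇒¬¬M carriesᵥ uv-cut λ Meᵥ → bichromatic⇒¬¬M carries_w uw-cut λ Me_w →
      matching-incident (𝒞 G) matching Meᵥ Me_w
        (Carries⇒Incident ¬iu carriesᵥ) (Carries⇒Incident ¬iu carries_w)
        (λ { refl → v≢w (Carries-functional G uv uw carriesᵥ carries_w) }))

  internal-cut-neighbour : SubdividedPath G a xs b → u ∈ xs → Adj G u v → colour u ≢ colour v →
                           v ≡ a ⊎ v ≡ b
  internal-cut-neighbour path u∈xs uv uv-cut with internal-neighbour G path u∈xs uv
  ... | inj₁ v∈xs = ⊥-elim (uv-cut (trans (colour-internal path u∈xs) (sym (colour-internal path v∈xs))))
  ... | inj₂ end  = end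

  internal-cut-to-both-ends : SubdividedPath G a xs b → u ∈ xs → colour u ≢ colour a → colour u ≢ colour b → ⊥
  internal-cut-to-both-ends {a = a} {b = b} path u∈xs ua-cut ub-cut
    with ∧-sel (side′ a (end-not-internal₁ G path)) (side′ b (end-not-internal₂ G path))
  ... | inj₁ ≡a = ua-cut (trans (colour-internal path u∈xs) (trans ≡a (sym (colour-external (a , _)))))
  ... | inj₂ ≡b = ub-cut (trans (colour-internal path u∈xs) (trans ≡b (sym (colour-external (b , _)))))

  cut-at-internal : ∀ {u v w} → SubdividedPath G a xs b → u ∈ xs → Adj G u v → Adj G u w →
                    colour u ≢ colour v → colour u ≢ colour w → v ≡ w
  cut-at-internal path u∈xs uv uw uv-cut uw-cut
    with internal-cut-neighbour path u∈xs uv uv-cut | internal-cut-neighbour path u∈xs uw uw-cut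
  ... | inj₁ refl | inj₁ refl = refl
  ... | inj₂ refl | inj₂ refl = refl
  ... | inj₁ refl | inj₂ refl = ⊥-elim (internal-cut-to-both-ends path u∈xs uv-cut uw-cut)
  ... | inj₂ refl | inj₁ refl = ⊥-elim (internal-cut-to-both-ends path u∈xs uw-cut uv-cut)

  cut-degree≤1 : ∀ {u v w} → Adj G u v → Adj G u w → colour u ≢ colour v → colour u ≢ colour w → v ≡ w
  cut-degree≤1 {u} = case Internal? G u of λ where
    (yes (_ , _ , _ , path , u∈xs)) → cut-at-internal path u∈xs
    (no ¬iu)                        → cut-at-external ¬iu

  CutEdge⇒colour≢ : ∀ {u v} → CutEdge G (tabulate colour) u v → colour u ≢ colour v
  CutEdge⇒colour≢ (_ , inj₁ (u∈ , v∉)) u≡v = v∉ (∈-tabulate⁺ (trans (sym u≡v) (∈-tabulate⁻ u∈)))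
  CutEdge⇒colour≢ (_ , inj₂ (u∉ , v∈)) u≡v = u∉ (∈-tabulate⁺ (trans u≡v (∈-tabulate⁻ v∈)))

  matchingCut : HasMatchingCut G
  matchingCut = tabulate colour
    , (value inner , ∈-tabulate⁺ (trans (colour-external inner) inner-side))
    , (value outer , λ outer∈ → true≢false (trans (sym (∈-tabulate⁻ outer∈))
                                                  (trans (colour-external outer) outer-side)))
    , λ u v w uv uw → cut-degree≤1 (proj₁ uv) (proj₁ uw) (CutEdge⇒colour≢ uv) (CutEdge⇒colour≢ uw)
    where
    true≢false : true ≢ false
    true≢false ()

proposition8 : (n : ℕ) (G : Graph n) → Subcubic G → ¬ IsCycle G →
    HasSeparatingMatching (𝒞 G) → HasMatchingCut G
proposition8 n G _ _ (M , matching , separating) =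
  matchingCut matching (separating⇒CutWithin (𝒞 G) separating)
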